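{- Let $G$ be a finite graph with $\alpha(G)=2$ and let $\mathfrak A$ be a partition of $V(G)$ into exactly $\chi(G)$ independent sets. Let $\{a_1,a_2\},\{b_1,b_2\},\{u\},\{v\}\in\mathfrak A$ be four distinct classes with $ua_1\notin E(G)$ and $vb_1\notin E(G)$. Then $\{u,v,a_2,b_2\}$ induces a complete graph $K_4$ in $G$; in particular $a_2b_2\in E(G)$. -}

module Defs where

open import Level using (0ℓ)
open import Data.Nat using (ℕ; suc; _≤_)
open import Data.Fin using (Fin)
open import Data.Product using (Σ; ∃; _×_)
open import Relation.Nullary using (¬_)
open import Relation.Binary.PropositionalEquality using (_≡_; _≢_)
open import Relation.Binary.Definitions using (Decidable)
open import Function.Definitions using (Injective; Surjective)

record Graph (n : ℕ) : Set₁ where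
  field
    Adj    : Fin n → Fin n → Set
    sym    : ∀ {x y} → Adj x y → Adj y x
    irrefl : ∀ {x} → ¬ Adj x x
    adj?   : Decidable Adj

open Graph public

HasIndepSet : ∀ {n} → Graph n → ℕ → Set
HasIndepSet {n} G k =
  Σ (Fin k → Fin n) λ f → Injective _≡_ _≡_ f × (∀ i j → ¬ Adj G (f i) (f j))

IndependenceNumber : ∀ {n} → Graph n → ℕ → Set
IndependenceNumber G k = HasIndepSet G k × (∀ m → HasIndepSet G m → m ≤ k)

IsProperColouring : ∀ {n k} → Graph n → (Fin n → Fin k) → Set
IsProperColouring G c = ∀ x y → Adj G x y → c x ≢ c y

Colourable : ∀ {n} → Graph n → ℕ → Set
Colourable {n} G k = Σ (Fin n → Fin k) λ c → IsProperColouring G c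

ChromaticNumber : ∀ {n} → Graph n → ℕ → Set
ChromaticNumber G k = Colourable G k × (∀ m → Colourable G m → k ≤ m)

-- A partition of V(G) into exactly k (nonempty) independent sets, given as
-- a surjective proper colouring c : Fin n → Fin k (classes = fibres of c).
IsIndepPartition : ∀ {n k} → Graph n → (Fin n → Fin k) → Set
IsIndepPartition G c = IsProperColouring G c × Surjective _≡_ _≡_ c

{-# OPTIONS --safe #-}
-- Three pairwise non-adjacent vertices would contradict α(G) = 2; this gives
-- u a₂ (u, a₁, a₂) and v b₂ (v, b₁, b₂).  In a colouring with χ(G) colours no
-- two classes are anticomplete, since merging them would free a colour; so
-- the singleton classes {u}, {v} are adjacent.  The other edges come from
-- recolouring first: were u b₂ a non-edge, moving b₂ into the class of u
-- would leave the classes {b₁}, {v} with v b₁ a non-edge; were a₂ b₂ a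
-- non-edge, moving a₁ to the class of u and b₁ to that of v would leave the
-- anticomplete classes {a₂}, {b₂}.  Swapping (a, u) with (b, v) gives v a₂.
module Submission where

open import Defs
open import Data.Nat using (ℕ; suc)
open import Data.Nat.Properties using (1+n≰n)
open import Data.Fin using (Fin; _≟_; punchOut)
open import Data.Fin.Patterns using (0F; 1F; 2F)
open import Data.Fin.Properties using (punchOut-injective)
open import Data.Vec using (Vec; []; _∷_; lookup)
open import Data.Vec.Relation.Unary.All using ([]; _∷_)
open import Data.Vec.Relation.Unary.AllPairs using ([]; _∷_)
open import Data.Vec.Relation.Unary.Unique.Propositional using (Unique)
open import Data.Vec.Relation.Unary.Unique.Propositional.Properties using (lookup-injective)
open import Data.Vec.Functional using (updateAt)
open import Data.Vec.Functional.Properties using (updateAt-updates; updateAt-minimal)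
open import Data.Product using (_×_; _,_; proj₂)
open import Data.Sum using (_⊎_; [_,_])
open import Data.Empty using (⊥-elim)
open import Function using (_∘_; const; id; flip)
open import Relation.Nullary using (¬_; yes; no; contradiction)
open import Relation.Nullary.Decidable using (decidable-stable)
open import Relation.Binary.PropositionalEquality
  using (_≡_; _≢_; refl; trans; cong; subst; subst₂) renaming (sym to ≡-sym)

recolour : ∀ {n k} → (Fin n → Fin k) → Fin n → Fin k → Fin n → Fin k
recolour d w p = updateAt d w (const p)

recolour-at : ∀ {n k} (d : Fin n → Fin k) w p → recolour d w p w ≡ p
recolour-at d w p = updateAt-updates w d

recolour-elsewhere : ∀ {n k} (d : Fin n → Fin k) p {w x} → x ≢ w → recolour d w p x ≡ d x
recolour-elsewhere d p {w} {x} = updateAt-minimal x w d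

recolour-fibre : ∀ {n k} (d : Fin n → Fin k) w {x p r} →
                 r ≢ p → recolour d w p x ≡ r → x ≢ w × d x ≡ r
recolour-fibre d w {x} {p} r≢p e with x ≟ w
... | yes refl = ⊥-elim (r≢p (trans (≡-sym e) (recolour-at d x p)))
... | no x≢w   = x≢w , trans (≡-sym (recolour-elsewhere d p x≢w)) e

merge : ∀ {k} → Fin k → Fin k → Fin k → Fin k
merge p q r with r ≟ q
... | yes _ = p
... | no  _ = r

merge-misses : ∀ {k} {p q : Fin k} → p ≢ q → ∀ r → merge p q r ≢ q
merge-misses {q = q} p≢q r with r ≟ q
... | yes _   = p≢q
... | no r≢q  = r≢q

module _ {n : ℕ} (G : Graph n) where

  Anticomplete : ∀ {k} → (Fin n → Fin k) → Fin k → Fin k → Set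
  Anticomplete d p q = ∀ x y → d x ≡ p → d y ≡ q → ¬ Adj G x y

  recolour-proper : ∀ {k} {d : Fin n → Fin k} {w p} → IsProperColouring G d →
                    (∀ y → d y ≡ p → ¬ Adj G w y) → IsProperColouring G (recolour d w p)
  recolour-proper {d = d} {w} {p} proper w-free x y x~y with x ≟ w | y ≟ w
  ... | yes refl | yes refl = ⊥-elim (irrefl G x~y)
  ... | yes refl | no y≢w =
    subst₂ _≢_ (≡-sym (recolour-at d w p)) (≡-sym (recolour-elsewhere d p y≢w))
      λ p≡dy → w-free y (≡-sym p≡dy) x~y
  ... | no x≢w | yes refl =
    subst₂ _≢_ (≡-sym (recolour-elsewhere d p x≢w)) (≡-sym (recolour-at d w p))
      λ dx≡p → w-free x dx≡p (Graph.sym G x~y)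
  ... | no x≢w | no y≢w =
    subst₂ _≢_ (≡-sym (recolour-elsewhere d p x≢w)) (≡-sym (recolour-elsewhere d p y≢w))
      (proper x y x~y)

  recolour-into-singleton-proper : ∀ {k} {d : Fin n → Fin k} {w p x} → IsProperColouring G d →
    (∀ y → d y ≡ p → y ≡ x) → ¬ Adj G x w → IsProperColouring G (recolour d w p)
  recolour-into-singleton-proper proper only-x x≁w =
    recolour-proper proper λ y dy≡p →
      subst (λ y → ¬ Adj G _ y) (≡-sym (only-x y dy≡p)) (x≁w ∘ Graph.sym G)

  merge-proper : ∀ {k} {d : Fin n → Fin k} {p q} → IsProperColouring G d →
                 Anticomplete d p q → IsProperColouring G (merge p q ∘ d)
  merge-proper {d = d} {p} {q} proper anticomplete x y x~y with d x ≟ q | d y ≟ q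
  ... | yes dx≡q | yes dy≡q = λ _ → proper x y x~y (trans dx≡q (≡-sym dy≡q))
  ... | yes dx≡q | no _     = λ p≡dy → anticomplete y x (≡-sym p≡dy) dx≡q (Graph.sym G x~y)
  ... | no _     | yes dy≡q = λ dx≡p → anticomplete x y dx≡p dy≡q x~y
  ... | no _     | no _     = proper x y x~y

  optimal-colouring-misses-no-colour : ∀ {k} {d : Fin n → Fin k} → ChromaticNumber G k →
    IsProperColouring G d → ∀ j → ¬ (∀ x → d x ≢ j)
  optimal-colouring-misses-no-colour {suc m} {d} χ proper j misses =
    1+n≰n (proj₂ χ m (d′ , proper′))
    where
      d′ : Fin n → Fin m
      d′ x = punchOut (misses x ∘ ≡-sym)
      proper′ : IsProperColouring G d′
      proper′ x y x~y = proper x y x~y ∘ punchOut-injective (misses x ∘ ≡-sym) (misses y ∘ ≡-sym)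

  optimal-classes-not-anticomplete : ∀ {k} {d : Fin n → Fin k} {p q} → ChromaticNumber G k →
    IsProperColouring G d → p ≢ q → ¬ Anticomplete d p q
  optimal-classes-not-anticomplete {d = d} {q = q} χ proper p≢q anticomplete =
    optimal-colouring-misses-no-colour χ (merge-proper proper anticomplete) q
      (merge-misses p≢q ∘ d)

  optimal-singleton-classes-adjacent : ∀ {k} {d : Fin n → Fin k} {p q x y} →
    ChromaticNumber G k → IsProperColouring G d → p ≢ q →
    (∀ z → d z ≡ p → z ≡ x) → (∀ z → d z ≡ q → z ≡ y) → Adj G x y
  optimal-singleton-classes-adjacent {x = x} {y} χ proper p≢q only-x only-y =
    decidable-stable (adj? G x y) λ x≁y →
      optimal-classes-not-anticomplete χ proper p≢q λ z w dz≡p dw≡q →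
        subst₂ (λ z w → ¬ Adj G z w) (≡-sym (only-x z dz≡p)) (≡-sym (only-y w dw≡q)) x≁y

  independent-triple : ∀ {x y z} → x ≢ y → x ≢ z → y ≢ z →
    ¬ Adj G x y → ¬ Adj G x z → ¬ Adj G y z → HasIndepSet G 3
  independent-triple {x} {y} {z} x≢y x≢z y≢z x≁y x≁z y≁z =
    lookup xyz , lookup-injective distinct _ _ , non-adjacent
    where
      xyz : Vec (Fin n) 3
      xyz = x ∷ y ∷ z ∷ []
      distinct : Unique xyz
      distinct = (x≢y ∷ x≢z ∷ []) ∷ (y≢z ∷ []) ∷ [] ∷ []
      non-adjacent : ∀ i j → ¬ Adj G (lookup xyz i) (lookup xyz j)
      non-adjacent 0F 0F = irrefl G
      non-adjacent 0F 1F = x≁y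
      non-adjacent 0F 2F = x≁z
      non-adjacent 1F 0F = x≁y ∘ Graph.sym G
      non-adjacent 1F 1F = irrefl G
      non-adjacent 1F 2F = y≁z
      non-adjacent 2F 0F = x≁z ∘ Graph.sym G
      non-adjacent 2F 1F = y≁z ∘ Graph.sym G
      non-adjacent 2F 2F = irrefl G

  classmate-of-non-neighbour-adjacent : ∀ {k} {c : Fin n → Fin k} {x y z} →
    IndependenceNumber G 2 → IsProperColouring G c →
    y ≢ z → c z ≡ c y → c y ≢ c x → ¬ Adj G x y → Adj G x z
  classmate-of-non-neighbour-adjacent {c = c} {x} {y} {z} α proper y≢z cz≡cy cy≢cx x≁y =
    decidable-stable (adj? G x z) λ x≁z →
      1+n≰n (proj₂ α 3 (independent-triple x≢y x≢z y≢z x≁y x≁z y≁z))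
    where
      x≢y : x ≢ y
      x≢y x≡y = cy≢cx (cong c (≡-sym x≡y))
      x≢z : x ≢ z
      x≢z x≡z = cy≢cx (trans (≡-sym cz≡cy) (cong c (≡-sym x≡z)))
      y≁z : ¬ Adj G y z
      y≁z y~z = proper y z y~z (≡-sym cz≡cy)

  singleton-adjacent-to-classmate-of-non-neighbour : ∀ {k} {c : Fin n → Fin k} {b₁ b₂ u v} →
    ChromaticNumber G k → IsProperColouring G c →
    (∀ x → c x ≡ c b₁ → x ≡ b₁ ⊎ x ≡ b₂) →
    (∀ x → c x ≡ c u → x ≡ u) → (∀ x → c x ≡ c v → x ≡ v) →
    c b₁ ≢ c u → c b₁ ≢ c v → c u ≢ c v → ¬ Adj G v b₁ → Adj G u b₂
  singleton-adjacent-to-classmate-of-non-neighbour {c = c} {b₁} {b₂} {u} {v}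
    χ proper b-class u-class v-class b₁u b₁v uv v≁b₁ =
    decidable-stable (adj? G u b₂) λ u≁b₂ →
      v≁b₁ (Graph.sym G (optimal-singleton-classes-adjacent χ
        (recolour-into-singleton-proper proper u-class u≁b₂) b₁v only-b₁ only-v))
    where
      only-b₁ : ∀ x → recolour c b₂ (c u) x ≡ c b₁ → x ≡ b₁
      only-b₁ x e with recolour-fibre c b₂ b₁u e
      ... | x≢b₂ , cx≡cb₁ = [ id , flip contradiction x≢b₂ ] (b-class x cx≡cb₁)
      only-v : ∀ x → recolour c b₂ (c u) x ≡ c v → x ≡ v
      only-v x e = v-class x (proj₂ (recolour-fibre c b₂ (uv ∘ ≡-sym) e))

  classmates-of-non-neighbours-adjacent : ∀ {k} {c : Fin n → Fin k} {a₁ a₂ b₁ b₂ u v} →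
    ChromaticNumber G k → IsProperColouring G c →
    (∀ x → c x ≡ c a₁ → x ≡ a₁ ⊎ x ≡ a₂) → (∀ x → c x ≡ c b₁ → x ≡ b₁ ⊎ x ≡ b₂) →
    (∀ x → c x ≡ c u → x ≡ u) → (∀ x → c x ≡ c v → x ≡ v) →
    c a₁ ≢ c b₁ → c a₁ ≢ c u → c a₁ ≢ c v → c b₁ ≢ c u → c b₁ ≢ c v → c u ≢ c v →
    ¬ Adj G u a₁ → ¬ Adj G v b₁ → Adj G a₂ b₂
  classmates-of-non-neighbours-adjacent {k} {c} {a₁} {a₂} {b₁} {b₂} {u} {v}
    χ proper a-class b-class u-class v-class ab au av bu bv uv u≁a₁ v≁b₁ =
    optimal-singleton-classes-adjacent χ proper₂ ab only-a₂ only-b₂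
    where
      d₁ : Fin n → Fin k
      d₁ = recolour c a₁ (c u)
      d₂ : Fin n → Fin k
      d₂ = recolour d₁ b₁ (c v)
      only-v : ∀ x → d₁ x ≡ c v → x ≡ v
      only-v x e = v-class x (proj₂ (recolour-fibre c a₁ (uv ∘ ≡-sym) e))
      proper₂ : IsProperColouring G d₂
      proper₂ = recolour-into-singleton-proper
        (recolour-into-singleton-proper proper u-class u≁a₁) only-v v≁b₁
      only-a₂ : ∀ x → d₂ x ≡ c a₁ → x ≡ a₂
      only-a₂ x e with recolour-fibre c a₁ au (proj₂ (recolour-fibre d₁ b₁ av e))
      ... | x≢a₁ , cx≡ca₁ = [ flip contradiction x≢a₁ , id ] (a-class x cx≡ca₁)
      only-b₂ : ∀ x → d₂ x ≡ c b₁ → x ≡ b₂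
      only-b₂ x e with recolour-fibre d₁ b₁ bv e
      ... | x≢b₁ , d₁x≡cb₁ =
        [ flip contradiction x≢b₁ , id ] (b-class x (proj₂ (recolour-fibre c a₁ bu d₁x≡cb₁)))

lemma3p4 : ∀ {n} (G : Graph n) (k : ℕ) (c : Fin n → Fin k) →
    IndependenceNumber G 2 → ChromaticNumber G k → IsIndepPartition G c →
    (a₁ a₂ b₁ b₂ u v : Fin n) →
    -- {a₁,a₂} is a class of the partition
    a₁ ≢ a₂ → c a₂ ≡ c a₁ → (∀ x → c x ≡ c a₁ → x ≡ a₁ ⊎ x ≡ a₂) →
    -- {b₁,b₂} is a class of the partition
    b₁ ≢ b₂ → c b₂ ≡ c b₁ → (∀ x → c x ≡ c b₁ → x ≡ b₁ ⊎ x ≡ b₂) →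
    -- {u} and {v} are classes of the partition
    (∀ x → c x ≡ c u → x ≡ u) → (∀ x → c x ≡ c v → x ≡ v) →
    -- the four classes are distinct
    c a₁ ≢ c b₁ → c a₁ ≢ c u → c a₁ ≢ c v → c b₁ ≢ c u → c b₁ ≢ c v → c u ≢ c v →
    ¬ Adj G u a₁ → ¬ Adj G v b₁ →
    -- {u, v, a₂, b₂} induces K₄
    Adj G u v × Adj G u a₂ × Adj G u b₂ × Adj G v a₂ × Adj G v b₂ × Adj G a₂ b₂
lemma3p4 G k c α χ (proper , _) a₁ a₂ b₁ b₂ u v
  a₁≢a₂ ca₂≡ca₁ a-class b₁≢b₂ cb₂≡cb₁ b-class u-class v-class ab au av bu bv uv u≁a₁ v≁b₁ =
    optimal-singleton-classes-adjacent G χ proper uv u-class v-class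
  , classmate-of-non-neighbour-adjacent G α proper a₁≢a₂ ca₂≡ca₁ au u≁a₁
  , singleton-adjacent-to-classmate-of-non-neighbour G χ proper b-class u-class v-class bu bv uv v≁b₁
  , singleton-adjacent-to-classmate-of-non-neighbour G χ proper a-class v-class u-class
      av au (uv ∘ ≡-sym) u≁a₁
  , classmate-of-non-neighbour-adjacent G α proper b₁≢b₂ cb₂≡cb₁ bv v≁b₁
  , classmates-of-non-neighbours-adjacent G χ proper a-class b-class u-class v-class
      ab au av bu bv uv u≁a₁ v≁b₁
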